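{- For every finite simple graph $H$ with $\tau(H)\ge 1$, we have $g(H)\ge \tau(H)+1$.
   Context: For a graph $H$, $\tau(H)$ denotes the minimum size of a set $X$ of vertices of $H$ such that $H-X$ is acyclic (a forest). For a graph $H$, $g(H)$ denotes the minimum integer $g\ge 0$ for which there exists a number $c=c(H)$ such that every $g$-connected finite simple graph that does not contain $H$ as a minor has pathwidth at most $c$ (this minimum exists). Here a graph $H$ is a minor of $G$ if $H$ is isomorphic to a graph obtained from a subgraph of $G$ by contracting edges. A path decomposition of a graph is a sequence $(B_1,\dots,B_n)$ of vertex subsets such that every vertex lies in some bag, for each vertex $v$ the set of indices $i$ with $v\in B_i$ is an interval, and every edge has both endpoints in some common bag; its width is $\max_i|B_i|-1$, and the pathwidth is the minimum width of a path decomposition. -}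

module Defs where

open import Data.Nat using (ℕ; zero; suc; _+_; _≤_; _<_)
open import Data.Fin using (Fin; zero; suc; inject₁; fromℕ)
open import Data.Fin.Subset using (Subset; _∈_; _∉_; ∣_∣)
open import Data.Bool using (Bool; true; false)
open import Data.Product using (Σ; ∃; ∃-syntax; _×_; _,_)
open import Data.Sum using (_⊎_)
open import Relation.Nullary using (¬_)
open import Relation.Binary.PropositionalEquality using (_≡_; _≢_)
open import Relation.Binary.Construct.Closure.ReflexiveTransitive using (Star)

record Graph : Set where
  field
    n      : ℕ
    E      : Fin n → Fin n → Bool
    sym    : ∀ x y → E x y ≡ E y x
    irrefl : ∀ x → E x x ≡ false

V : Graph → Set
V G = Fin (Graph.n G)

Adj : (G : Graph) → V G → V G → Set
Adj G x y = Graph.E G x y ≡ true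

_⇔_ : Set → Set → Set
A ⇔ B = (A → B) × (B → A)

Iso : Graph → Graph → Set
Iso G K =
  Σ (V G → V K) λ f → Σ (V K → V G) λ h →
    (∀ x → h (f x) ≡ x) × (∀ a → f (h a) ≡ a) ×
    (∀ x y → Adj G x y ⇔ Adj K (f x) (f y))

Subgraph : Graph → Graph → Set
Subgraph S G =
  Σ (V S → V G) λ f →
    (∀ x y → f x ≡ f y → x ≡ y) ×
    (∀ x y → Adj S x y → Adj G (f x) (f y))

-- K is obtained from G by contracting one edge uv (simple-graph
-- contraction: u and v are identified, loops and parallel edges dropped).
ContractEdge : Graph → Graph → Set
ContractEdge G K =
  Σ (V G) λ u → Σ (V G) λ v → Adj G u v ×
  Σ (V G → V K) λ φ →
    (∀ a → ∃[ x ] φ x ≡ a) ×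
    φ u ≡ φ v ×
    (∀ x y → φ x ≡ φ y →
       x ≡ y ⊎ ((x ≡ u × y ≡ v) ⊎ (x ≡ v × y ≡ u))) ×
    (∀ a b → Adj K a b ⇔
       (a ≢ b × ∃[ x ] ∃[ y ] (φ x ≡ a × φ y ≡ b × Adj G x y)))

Minor : Graph → Graph → Set
Minor H G = ∃[ S ] ∃[ K ] (Subgraph S G × Star ContractEdge S K × Iso K H)

-- A cycle of length k+3 in G avoiding X: distinct vertices c 0 … c (k+2),
-- consecutive ones adjacent, and the last adjacent to the first.
CycleAvoiding : (G : Graph) → Subset (Graph.n G) → Set
CycleAvoiding G X =
  Σ ℕ λ k → Σ (Fin (suc (suc (suc k))) → V G) λ c →
    (∀ i j → c i ≡ c j → i ≡ j) ×
    (∀ i → c i ∉ X) ×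
    (∀ (i : Fin (suc (suc k))) → Adj G (c (inject₁ i)) (c (suc i))) ×
    Adj G (c (fromℕ (suc (suc k)))) (c zero)

ForestAfterDeleting : (G : Graph) → Subset (Graph.n G) → Set
ForestAfterDeleting G X = ¬ CycleAvoiding G X

IsTau : Graph → ℕ → Set
IsTau G t =
  (Σ (Subset (Graph.n G)) λ X → ∣ X ∣ ≡ t × ForestAfterDeleting G X) ×
  (∀ X → ForestAfterDeleting G X → t ≤ ∣ X ∣)

StepAvoiding : (G : Graph) → Subset (Graph.n G) → V G → V G → Set
StepAvoiding G X x y = Adj G x y × x ∉ X × y ∉ X

ConnectedAfterDeleting : (G : Graph) → Subset (Graph.n G) → Set
ConnectedAfterDeleting G X =
  ∀ x y → x ∉ X → y ∉ X → Star (StepAvoiding G X) x y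

KConnected : ℕ → Graph → Set
KConnected k G =
  k < Graph.n G ×
  (∀ X → ∣ X ∣ < k → ConnectedAfterDeleting G X)

PathDecompOfWidth≤ : (G : Graph) → ℕ → Set
PathDecompOfWidth≤ G c =
  Σ ℕ λ m → Σ (Fin m → Subset (Graph.n G)) λ B →
    (∀ v → ∃[ i ] v ∈ B i) ×
    (∀ v (i j k : Fin m) → Data.Fin._≤_ i j → Data.Fin._≤_ j k →
       v ∈ B i → v ∈ B k → v ∈ B j) ×
    (∀ x y → Adj G x y → ∃[ i ] (x ∈ B i × y ∈ B i)) ×
    (∀ i → ∣ B i ∣ ≤ suc c)

PathwidthAtMost : Graph → ℕ → Set
PathwidthAtMost G c = PathDecompOfWidth≤ G c

-- The property defining g(H): there is c such that every g-connected
-- graph without an H minor has pathwidth at most c.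
-- g(H) is the least g with Works H g.

Works : Graph → ℕ → Set
Works H g =
  ∃[ c ] (∀ G → KConnected g G → ¬ Minor H G → PathwidthAtMost G c)

-- Let a = τ(H) − 1 and join a universal apices to a complete ternary tree of depth K. Deleting at
-- most a vertices spares an apex or leaves the tree, so this graph is (a + 1)-connected; the apices
-- form a feedback vertex set of size a, and τ is minor-monotone, so it has no H minor. Yet the
-- tree has pathwidth at least K: by induction on d, some bag holds d + 1 vertices of a subtree of
-- depth d, the extra vertex coming from a walk between two child subtrees through the root.

module Submission where

open import Defs
open import Data.Nat using (ℕ; _≤_)
open import Relation.Nullary using (¬_)

open import Data.Nat as ℕ using (zero; suc; _+_; _∸_; _<_; z≤n; s≤s; _≤?_; _<?_)
open import Data.Nat.Properties
open import Data.Nat.DivMod using (_%_; n%n≡0; %-distribˡ-+; m%n%n≡m%n; m%n<n; [m+n]%n≡m%n; m<n⇒m%n≡m)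
open import Data.Nat.Induction using (<-rec)
open import Data.Fin as Fin using (Fin; zero; suc; toℕ; fromℕ<; _↑ˡ_; _↑ʳ_; splitAt)
import Data.Fin.Properties as Finₚ
open import Data.Fin.Subset using (Subset; _∈_; _∉_; ∣_∣; ⊤; _-_; inside; outside)
open import Data.Fin.Subset.Properties using (_∈?_; ∈⊤; ∣⊤∣≡n; x∈p⇒∣p-x∣<∣p∣; x∈p∧x≢y⇒x∈p-y)
open import Data.Vec using ([]; _∷_; here; there; tabulate)
open import Data.Vec.Properties using (lookup⇒[]=; []=⇒lookup; lookup∘tabulate)
open import Data.Bool using (Bool; true; false; not)
open import Data.Product using (Σ; ∃-syntax; _×_; _,_; proj₁; proj₂)
open import Data.Sum using (_⊎_; inj₁; inj₂; [_,_]′)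
open import Data.Empty using (⊥)
open import Function using (_∘_; const)
open import Function.Bundles using (mk⇔)
open import Function.Definitions using (Injective)
open import Relation.Nullary using (Dec; yes; no; does; contradiction; ¬?)
open import Relation.Nullary.Decidable using (decidable-stable; dec-true; dec-false; does-⇔; _×-dec_; _⊎-dec_)
open import Relation.Binary.PropositionalEquality
open import Relation.Binary.Construct.Closure.ReflexiveTransitive as Star using (Star; ε; _◅_; _◅◅_)

injectiveOn⇒∣p∣≤∣q∣ : ∀ {n m} (p : Subset n) (q : Subset m) (f : ∀ {x} → x ∈ p → Fin m) →
  (∀ {x y} (x∈p : x ∈ p) (y∈p : y ∈ p) → f x∈p ≡ f y∈p → x ≡ y) →
  (∀ {x} (x∈p : x ∈ p) → f x∈p ∈ q) → ∣ p ∣ ≤ ∣ q ∣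
injectiveOn⇒∣p∣≤∣q∣ [] q f f-inj f∈q = z≤n
injectiveOn⇒∣p∣≤∣q∣ (outside ∷ p) q f f-inj f∈q =
  injectiveOn⇒∣p∣≤∣q∣ p q (f ∘ there)
    (λ x∈p y∈p eq → Finₚ.suc-injective (f-inj (there x∈p) (there y∈p) eq)) (f∈q ∘ there)
injectiveOn⇒∣p∣≤∣q∣ (inside ∷ p) q f f-inj f∈q = begin
  suc ∣ p ∣           ≤⟨ s≤s (injectiveOn⇒∣p∣≤∣q∣ p (q - f here) (f ∘ there)
                           (λ x∈p y∈p eq → Finₚ.suc-injective (f-inj (there x∈p) (there y∈p) eq))
                           (λ x∈p → x∈p∧x≢y⇒x∈p-y (f∈q (there x∈p))
                              (λ eq → Finₚ.0≢1+n (f-inj here (there x∈p) (sym eq))))) ⟩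
  suc ∣ q - f here ∣  ≤⟨ x∈p⇒∣p-x∣<∣p∣ (f∈q here) ⟩
  ∣ q ∣               ∎
  where open ≤-Reasoning

injective⇒n≤∣q∣ : ∀ {n m} (q : Subset m) (f : Fin n → Fin m) → Injective _≡_ _≡_ f →
  (∀ x → f x ∈ q) → n ≤ ∣ q ∣
injective⇒n≤∣q∣ {n} q f f-inj f∈q = subst (_≤ ∣ q ∣) (∣⊤∣≡n n)
  (injectiveOn⇒∣p∣≤∣q∣ ⊤ q (λ {x} _ → f x) (λ _ _ → f-inj) (λ {x} _ → f∈q x))

⊆-image⇒∣p∣≤∣q∣ : ∀ {n m} (p : Subset m) (q : Subset n) (φ : Fin n → Fin m) →
  (∀ {a} → a ∈ p → ∃[ x ] (x ∈ q × φ x ≡ a)) → ∣ p ∣ ≤ ∣ q ∣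
⊆-image⇒∣p∣≤∣q∣ p q φ preimage = injectiveOn⇒∣p∣≤∣q∣ p q (proj₁ ∘ preimage)
  (λ a∈p b∈p eq → trans (sym (proj₂ (proj₂ (preimage a∈p))))
                        (trans (cong φ eq) (proj₂ (proj₂ (preimage b∈p)))))
  (proj₁ ∘ proj₂ ∘ preimage)

does⇒ : ∀ {A : Set} (a? : Dec A) → does a? ≡ true → A
does⇒ (yes a) _ = a

module _ {n} {P : Fin n → Set} (P? : ∀ x → Dec (P x)) where

  subsetOf : Subset n
  subsetOf = tabulate (does ∘ P?)

  ∈-subsetOf⁺ : ∀ {x} → P x → x ∈ subsetOf
  ∈-subsetOf⁺ {x} px = lookup⇒[]= x subsetOf (trans (lookup∘tabulate _ x) (dec-true (P? x) px))

  ∈-subsetOf⁻ : ∀ {x} → x ∈ subsetOf → P x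
  ∈-subsetOf⁻ {x} x∈ = does⇒ (P? x) (trans (sym (lookup∘tabulate (does ∘ P?) x)) ([]=⇒lookup x∈))

adj-sym : ∀ (G : Graph) {x y} → Adj G x y → Adj G y x
adj-sym G {x} {y} xy = trans (Graph.sym G y x) xy

adj⇒≢ : ∀ (G : Graph) {x y} → Adj G x y → x ≢ y
adj⇒≢ G {x} xy refl with trans (sym xy) (Graph.irrefl G x)
... | ()

record Path (G : Graph) (X : Subset (Graph.n G)) (n : ℕ) : Set where
  field
    at        : ℕ → V G
    injective : ∀ {i j} → i ≤ n → j ≤ n → at i ≡ at j → i ≡ j
    avoids    : ∀ {i} → i ≤ n → at i ∉ X
    steps     : ∀ {i} → i < n → Adj G (at i) (at (suc i))

-- Cycles have length 3 + k.
record Cycle (G : Graph) (X : Subset (Graph.n G)) : Set where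
  field
    k    : ℕ
    path : Path G X (2 + k)
  open Path path public
  field
    closes : Adj G (at (2 + k)) (at 0)

Acyclic : (G : Graph) → Subset (Graph.n G) → Set
Acyclic G X = ¬ Cycle G X

-- clamp i is i as an element of Fin (suc n) when i ≤ n, and the junk value 0 otherwise.
clamp : ∀ {n} → ℕ → Fin (suc n)
clamp {n} i with i ≤? n
... | yes i≤n = fromℕ< (s≤s i≤n)
... | no _    = zero

toℕ-clamp : ∀ {n i} → i ≤ n → toℕ (clamp {n} i) ≡ i
toℕ-clamp {n} {i} i≤n with i ≤? n
... | yes _   = Finₚ.toℕ-fromℕ< _
... | no i≰n  = contradiction i≤n i≰n

clamp-toℕ : ∀ {n i} {j : Fin (suc n)} → i ≤ n → toℕ j ≡ i → clamp i ≡ j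
clamp-toℕ i≤n eq = Finₚ.toℕ-injective (trans (toℕ-clamp i≤n) (sym eq))

cycleAvoiding⇒Cycle : ∀ {G X} → CycleAvoiding G X → Cycle G X
cycleAvoiding⇒Cycle {G} {X} (k , c , c-inj , c-avoids , c-steps , c-closes) = record
  { k    = k
  ; path = record
    { at        = c ∘ clamp
    ; injective = λ i≤ j≤ eq →
        trans (sym (toℕ-clamp i≤)) (trans (cong toℕ (c-inj _ _ eq)) (toℕ-clamp j≤))
    ; avoids    = λ _ → c-avoids _
    ; steps     = steps
    }
  ; closes = subst₂ (Adj G) (cong c (sym (clamp-toℕ ≤-refl (Finₚ.toℕ-fromℕ _))))
                            (cong c (sym (clamp-toℕ z≤n refl))) c-closes
  }
  where
  steps : ∀ {i} → i < 2 + k → Adj G (c (clamp i)) (c (clamp (suc i)))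
  steps {i} i< = subst₂ (Adj G)
    (cong c (sym (clamp-toℕ (<⇒≤ i<) (trans (Finₚ.toℕ-inject₁ (fromℕ< i<)) (Finₚ.toℕ-fromℕ< i<)))))
    (cong c (sym (clamp-toℕ i< (cong suc (Finₚ.toℕ-fromℕ< i<)))))
    (c-steps (fromℕ< i<))

module _ {G H : Graph} {X : Subset (Graph.n G)} {Y : Subset (Graph.n H)}
         (P : V G → Set) (f : V G → V H) (f-injective : Injective _≡_ _≡_ f)
         (f-adj : ∀ {x y} → P x → P y → Adj G x y → Adj H (f x) (f y))
         (f-avoids : ∀ {x} → x ∉ X → f x ∉ Y) where

  mapPath : ∀ {n} (p : Path G X n) → (∀ {i} → i ≤ n → P (Path.at p i)) → Path H Y n
  mapPath p on-P = record
    { at        = f ∘ at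
    ; injective = λ i≤ j≤ → injective i≤ j≤ ∘ f-injective
    ; avoids    = f-avoids ∘ avoids
    ; steps     = λ i< → f-adj (on-P (<⇒≤ i<)) (on-P i<) (steps i<)
    }
    where open Path p

  mapCycle : (C : Cycle G X) → (∀ {i} → i ≤ 2 + Cycle.k C → P (Cycle.at C i)) → Cycle H Y
  mapCycle C on-P = record
    { k = k ; path = mapPath path on-P ; closes = f-adj (on-P ≤-refl) (on-P z≤n) closes }
    where open Cycle C

extend : ∀ {A : Set} → (ℕ → A) → ℕ → A → ℕ → A
extend f n z i with i ≤? n
... | yes _ = f i
... | no _  = z

extend-≤ : ∀ {A : Set} (f : ℕ → A) {n} z {i} → i ≤ n → extend f n z i ≡ f i
extend-≤ f {n} z {i} i≤n with i ≤? n
... | yes _  = refl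
... | no i≰n = contradiction i≤n i≰n

extend-last : ∀ {A : Set} (f : ℕ → A) n z → extend f n z (suc n) ≡ z
extend-last f n z with suc n ≤? n
... | yes 1+n≤n = contradiction 1+n≤n (n≮n n)
... | no _      = refl

module _ {G : Graph} {X : Subset (Graph.n G)} where

  snoc : ∀ {n} (p : Path G X n) (z : V G) → z ∉ X → (∀ {i} → i ≤ n → Path.at p i ≢ z) →
         Adj G (Path.at p n) z → Path G X (suc n)
  snoc {n} p z z∉X fresh pₙ~z = record
    { at        = at′
    ; injective = injective′
    ; avoids    = avoids′
    ; steps     = steps′
    }
    where
    open Path p
    at′ = extend at n z

    at′-cases : ∀ {i} → i ≤ suc n → (i ≤ n × at′ i ≡ at i) ⊎ (i ≡ suc n × at′ i ≡ z)
    at′-cases i≤ with m≤n⇒m<n∨m≡n i≤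
    ... | inj₁ i<  = inj₁ (≤-pred i< , extend-≤ at z (≤-pred i<))
    ... | inj₂ refl = inj₂ (refl , extend-last at n z)

    injective′ : ∀ {i j} → i ≤ suc n → j ≤ suc n → at′ i ≡ at′ j → i ≡ j
    injective′ i≤ j≤ eq with at′-cases i≤ | at′-cases j≤
    ... | inj₁ (i≤n , eqi) | inj₁ (j≤n , eqj) = injective i≤n j≤n (trans (sym eqi) (trans eq eqj))
    ... | inj₁ (i≤n , eqi) | inj₂ (_ , eqj)   = contradiction (trans (sym eqi) (trans eq eqj)) (fresh i≤n)
    ... | inj₂ (_ , eqi)   | inj₁ (j≤n , eqj) = contradiction (trans (sym eqj) (trans (sym eq) eqi)) (fresh j≤n)
    ... | inj₂ (refl , _)  | inj₂ (refl , _)  = refl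

    avoids′ : ∀ {i} → i ≤ suc n → at′ i ∉ X
    avoids′ i≤ with at′-cases i≤
    ... | inj₁ (i≤n , eq) = subst (_∉ X) (sym eq) (avoids i≤n)
    ... | inj₂ (_ , eq)   = subst (_∉ X) (sym eq) z∉X

    steps′ : ∀ {i} → i < suc n → Adj G (at′ i) (at′ (suc i))
    steps′ {i} i< with m≤n⇒m<n∨m≡n (≤-pred i<)
    ... | inj₁ i<n  = subst₂ (Adj G) (sym (extend-≤ at z (<⇒≤ i<n))) (sym (extend-≤ at z i<n)) (steps i<n)
    ... | inj₂ refl = subst₂ (Adj G) (sym (extend-≤ at z ≤-refl)) (sym (extend-last at n z)) pₙ~z

  closePath : ∀ {k} (p : Path G X (2 + k)) (z : V G) → z ∉ X →
    (∀ {i} → 0 < i → i ≤ 2 + k → Path.at p i ≢ z) →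
    Adj G (Path.at p (2 + k)) z → z ≡ Path.at p 0 ⊎ Adj G z (Path.at p 0) → Cycle G X
  closePath {k} p z _ _ pₙ~z (inj₁ refl) = record { k = k ; path = p ; closes = pₙ~z }
  closePath {k} p z z∉X fresh pₙ~z (inj₂ z~p₀) = record
    { k      = suc k
    ; path   = snoc p z z∉X fresh′ pₙ~z
    ; closes = subst₂ (Adj G) (sym (extend-last at (2 + k) z)) (sym (extend-≤ at {2 + k} z z≤n)) z~p₀
    }
    where
    open Path p
    fresh′ : ∀ {i} → i ≤ 2 + k → at i ≢ z
    fresh′ {zero}  _  eq = adj⇒≢ G z~p₀ (sym eq)
    fresh′ {suc i} i≤ = fresh (s≤s z≤n) i≤

%-absorbʳ : ∀ m n d .{{_ : ℕ.NonZero d}} → (m + n % d) % d ≡ (m + n) % d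
%-absorbʳ m n d = begin
  (m + n % d) % d           ≡⟨ %-distribˡ-+ m (n % d) d ⟩
  (m % d + n % d % d) % d   ≡⟨ cong (λ r → (m % d + r) % d) (m%n%n≡m%n n d) ⟩
  (m % d + n % d) % d       ≡⟨ %-distribˡ-+ m n d ⟨
  (m + n) % d               ∎
  where open ≡-Reasoning

module _ {G : Graph} {X : Subset (Graph.n G)} (C : Cycle G X) where
  open Cycle C

  private
    L : ℕ
    L = 3 + k

    mod-step : ∀ i → Adj G (at (i % L)) (at (suc i % L))
    mod-step i with m≤n⇒m<n∨m≡n (m%n<n i L)
    ... | inj₁ 1+i%L<L = subst (Adj G (at (i % L)) ∘ at) next (steps (≤-pred 1+i%L<L))
      where
      next : suc (i % L) ≡ suc i % L
      next = trans (sym (m<n⇒m%n≡m 1+i%L<L)) (%-absorbʳ 1 i L)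
    ... | inj₂ 1+i%L≡L = subst₂ (λ a b → Adj G (at a) (at b)) last first closes
      where
      last : 2 + k ≡ i % L
      last = sym (suc-injective 1+i%L≡L)
      first : 0 ≡ suc i % L
      first = trans (sym (n%n≡0 L)) (trans (cong (_% L) (sym 1+i%L≡L)) (%-absorbʳ 1 i L))

    unrotate : ∀ {r i} → r ≤ L → i < L → (L ∸ r + (i + r) % L) % L ≡ i
    unrotate {r} {i} r≤L i<L = begin
      (L ∸ r + (i + r) % L) % L  ≡⟨ %-absorbʳ (L ∸ r) (i + r) L ⟩
      (L ∸ r + (i + r)) % L      ≡⟨ cong (_% L) shuffle ⟩
      (i + L) % L                ≡⟨ [m+n]%n≡m%n i L ⟩
      i % L                      ≡⟨ m<n⇒m%n≡m i<L ⟩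
      i                          ∎
      where
      open ≡-Reasoning
      shuffle : L ∸ r + (i + r) ≡ i + L
      shuffle = begin
        L ∸ r + (i + r)  ≡⟨ cong (L ∸ r +_) (+-comm i r) ⟩
        L ∸ r + (r + i)  ≡⟨ +-assoc (L ∸ r) r i ⟨
        L ∸ r + r + i    ≡⟨ cong (_+ i) (m∸n+n≡m r≤L) ⟩
        L + i            ≡⟨ +-comm L i ⟩
        i + L            ∎

  rotate : ∀ r → r ≤ 2 + k → Cycle G X
  rotate r r≤ = record
    { k    = k
    ; path = record
      { at        = λ i → at ((i + r) % L)
      ; injective = λ {i} {j} i≤ j≤ eq →
          trans (sym (unrotate (m≤n⇒m≤1+n r≤) (s≤s i≤)))
            (trans (cong (λ m → (L ∸ r + m) % L)
                     (injective (≤-pred (m%n<n (i + r) L)) (≤-pred (m%n<n (j + r) L)) eq))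
                   (unrotate (m≤n⇒m≤1+n r≤) (s≤s j≤)))
      ; avoids    = λ {i} _ → avoids (≤-pred (m%n<n (i + r) L))
      ; steps     = λ {i} _ → mod-step (i + r)
      }
    ; closes = subst (Adj G (at ((2 + k + r) % L)) ∘ at) wrap (mod-step (2 + k + r))
    }
    where
    wrap : (L + r) % L ≡ r % L
    wrap = trans (cong (_% L) (+-comm L r)) ([m+n]%n≡m%n r L)

  rotate-start : ∀ {r} (r≤ : r ≤ 2 + k) → Cycle.at (rotate r r≤) 0 ≡ at r
  rotate-start r≤ = cong at (m<n⇒m%n≡m (s≤s r≤))

∃-argmax : (f : ℕ → ℕ) (n : ℕ) → ∃[ i ] (i ≤ n × (∀ {j} → j ≤ n → f j ≤ f i))
∃-argmax f zero = 0 , z≤n , λ { z≤n → ≤-refl }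
∃-argmax f (suc n) with ∃-argmax f n
... | i , i≤n , max with f i ≤? f (suc n)
...   | yes fi≤ = suc n , ≤-refl , λ j≤ →
  [ (λ j< → ≤-trans (max (≤-pred j<)) fi≤) , (λ { refl → ≤-refl }) ]′ (m≤n⇒m<n∨m≡n j≤)
...   | no fi≰  = i , m≤n⇒m≤1+n i≤n , λ j≤ →
  [ (λ j< → max (≤-pred j<)) , (λ { refl → <⇒≤ (≰⇒> fi≰) }) ]′ (m≤n⇒m<n∨m≡n j≤)

-- At a highest vertex of a cycle both cycle-neighbours are lower, so they would coincide.
module _ (G : Graph) (X : Subset (Graph.n G)) (h : V G → ℕ)
         (h-injective : ∀ {x y} → x ∉ X → y ∉ X → h x ≡ h y → x ≡ y)
         (lower-unique : ∀ {x y z} → x ∉ X → y ∉ X → z ∉ X → Adj G x z → Adj G y z →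
                         h x < h z → h y < h z → x ≡ y) where

  private
    highestStart⇒⊥ : (C : Cycle G X) →
      (∀ {j} → j ≤ 2 + Cycle.k C → h (Cycle.at C j) ≤ h (Cycle.at C 0)) → ⊥
    highestStart⇒⊥ C highest = 0≢1+k (suc-injective (injective one≤ last≤ (lower-unique
      (avoids one≤) (avoids last≤) (avoids z≤n) (adj-sym G (steps (s≤s z≤n))) closes
      (lower one≤ λ ()) (lower last≤ λ ()))))
      where
      open Cycle C
      one≤ : 1 ≤ 2 + k
      one≤ = s≤s z≤n
      last≤ : 2 + k ≤ 2 + k
      last≤ = ≤-refl
      0≢1+k : 0 ≢ suc k
      0≢1+k ()
      lower : ∀ {j} → j ≤ 2 + k → j ≢ 0 → h (at j) < h (at 0)
      lower j≤ j≢0 = ≤∧≢⇒< (highest j≤) (j≢0 ∘ injective j≤ z≤n ∘ h-injective (avoids j≤) (avoids z≤n))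

  acyclic-byHeight : Acyclic G X
  acyclic-byHeight C with ∃-argmax (h ∘ Cycle.at C) (2 + Cycle.k C)
  ... | r , r≤ , max = highestStart⇒⊥ (rotate C r r≤) λ {j} _ →
    subst (λ v → h (Cycle.at C ((j + r) % (3 + Cycle.k C))) ≤ h v) (sym (rotate-start C r≤))
      (max (≤-pred (m%n<n (j + r) (3 + Cycle.k C))))

-- Minor-monotonicity of τ

-- Witnesses τ(H) ≤ τ(G).
FvsTransfer : Graph → Graph → Set
FvsTransfer G H = ∀ X → Acyclic G X → ∃[ Y ] (∣ Y ∣ ≤ ∣ X ∣ × Acyclic H Y)

fvs-refl : ∀ {G} → FvsTransfer G G
fvs-refl X acyclic = X , ≤-refl , acyclic

fvs-trans : ∀ {G H K} → FvsTransfer G H → FvsTransfer H K → FvsTransfer G K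
fvs-trans G→H H→K X acyclic with G→H X acyclic
... | Y , ∣Y∣≤ , acyclicY with H→K Y acyclicY
... | Z , ∣Z∣≤ , acyclicZ = Z , ≤-trans ∣Z∣≤ ∣Y∣≤ , acyclicZ

fvs-embedding : ∀ {G H} (f : V H → V G) → Injective _≡_ _≡_ f →
  (∀ {x y} → Adj H x y → Adj G (f x) (f y)) → FvsTransfer G H
fvs-embedding {G} {H} f f-inj f-adj X acyclic =
  Y , injectiveOn⇒∣p∣≤∣q∣ Y X (λ {x} _ → f x) (λ _ _ → f-inj) (∈-subsetOf⁻ f∈X?) ,
  λ C → acyclic (mapCycle (_∉ Y) f f-inj (λ _ _ → f-adj) f-avoids C (Cycle.avoids C))
  where
  f∈X? : ∀ x → Dec (f x ∈ X)
  f∈X? x = f x ∈? X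
  Y : Subset (Graph.n H)
  Y = subsetOf f∈X?
  f-avoids : ∀ {x} → x ∉ Y → f x ∉ X
  f-avoids x∉Y fx∈X = x∉Y (∈-subsetOf⁺ f∈X? fx∈X)

fvs-subgraph : ∀ {S G} → Subgraph S G → FvsTransfer G S
fvs-subgraph (f , f-inj , f-adj) = fvs-embedding f (f-inj _ _) (f-adj _ _)

fvs-iso : ∀ {K H} → Iso K H → FvsTransfer K H
fvs-iso {K} {H} (f , g , gf , fg , f-adj) = fvs-embedding g g-inj g-adj
  where
  g-inj : Injective _≡_ _≡_ g
  g-inj {x} {y} eq = trans (sym (fg x)) (trans (cong f eq) (fg y))
  g-adj : ∀ {x y} → Adj H x y → Adj K (g x) (g y)
  g-adj {x} {y} xy = proj₂ (f-adj (g x) (g y)) (subst₂ (Adj H) (sym (fg x)) (sym (fg y)) xy)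

module Contraction {S K : Graph} (u v : V S) (uv : Adj S u v) (φ : V S → V K)
  (φ-onto : ∀ a → ∃[ x ] φ x ≡ a) (φu≡φv : φ u ≡ φ v)
  (φ-fibres : ∀ x y → φ x ≡ φ y → x ≡ y ⊎ ((x ≡ u × y ≡ v) ⊎ (x ≡ v × y ≡ u)))
  (K-adj : ∀ a b → Adj K a b ⇔ (a ≢ b × ∃[ x ] ∃[ y ] (φ x ≡ a × φ y ≡ b × Adj S x y)))
  where

  w : V K
  w = φ u

  lift : V K → V S
  lift a = proj₁ (φ-onto a)

  φ∘lift : ∀ a → φ (lift a) ≡ a
  φ∘lift a = proj₂ (φ-onto a)

  lift-injective : Injective _≡_ _≡_ lift
  lift-injective {a} {b} eq = trans (sym (φ∘lift a)) (trans (cong φ eq) (φ∘lift b))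

  fibre≢w : ∀ {a x} → a ≢ w → φ x ≡ a → x ≡ lift a
  fibre≢w {a} {x} a≢w eq with φ-fibres x (lift a) (trans eq (sym (φ∘lift a)))
  ... | inj₁ x≡       = x≡
  ... | inj₂ (inj₁ (refl , _)) = contradiction (sym eq) a≢w
  ... | inj₂ (inj₂ (refl , _)) = contradiction (trans (sym eq) (sym φu≡φv)) a≢w

  fibre-w : ∀ {x} → φ x ≡ w → x ≡ u ⊎ x ≡ v
  fibre-w {x} eq with φ-fibres x u eq
  ... | inj₁ x≡u              = inj₁ x≡u
  ... | inj₂ (inj₁ (x≡u , _)) = inj₁ x≡u
  ... | inj₂ (inj₂ (x≡v , _)) = inj₂ x≡v

  fibre-w-adj : ∀ {x y} → φ x ≡ w → φ y ≡ w → x ≡ y ⊎ Adj S x y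
  fibre-w-adj φx≡w φy≡w with fibre-w φx≡w | fibre-w φy≡w
  ... | inj₁ refl | inj₁ refl = inj₁ refl
  ... | inj₁ refl | inj₂ refl = inj₂ uv
  ... | inj₂ refl | inj₁ refl = inj₂ (adj-sym S uv)
  ... | inj₂ refl | inj₂ refl = inj₁ refl

  edge-preimage : ∀ {a b} → Adj K a b → ∃[ x ] ∃[ y ] (φ x ≡ a × φ y ≡ b × Adj S x y)
  edge-preimage {a} {b} ab = proj₂ (proj₁ (K-adj a b) ab)

  lift-adj : ∀ {a b} → a ≢ w → b ≢ w → Adj K a b → Adj S (lift a) (lift b)
  lift-adj a≢w b≢w ab with edge-preimage ab
  ... | x , y , refl , refl , xy = subst₂ (Adj S) (fibre≢w a≢w refl) (fibre≢w b≢w refl) xy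

  module _ (X : Subset (Graph.n S)) where

    φ[X]? : ∀ a → Dec (∃[ x ] (x ∈ X × φ x ≡ a))
    φ[X]? a = Finₚ.any? (λ x → (x ∈? X) ×-dec (φ x Finₚ.≟ a))

    φ[X] : Subset (Graph.n K)
    φ[X] = subsetOf φ[X]?

    ∣φ[X]∣≤∣X∣ : ∣ φ[X] ∣ ≤ ∣ X ∣
    ∣φ[X]∣≤∣X∣ = ⊆-image⇒∣p∣≤∣q∣ φ[X] X φ (∈-subsetOf⁻ φ[X]?)

    preimage-avoids : ∀ {a x} → a ∉ φ[X] → φ x ≡ a → x ∉ X
    preimage-avoids a∉φ[X] eq x∈X = a∉φ[X] (∈-subsetOf⁺ φ[X]? (_ , x∈X , eq))

    module _ (acyclic : Acyclic S X) where

      missing-w⇒⊥ : (C : Cycle K φ[X]) → (∀ {i} → i ≤ 2 + Cycle.k C → Cycle.at C i ≢ w) → ⊥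
      missing-w⇒⊥ C ≢w = acyclic (mapCycle (_≢ w) lift lift-injective lift-adj
        (λ a∉ → preimage-avoids a∉ (φ∘lift _)) C ≢w)

      -- Lift at 1, …, at (2 + k) and close it up through the preimages of w: one of them, or both
      -- joined by the contracted edge uv.
      starting-at-w⇒⊥ : (C : Cycle K φ[X]) → Cycle.at C 0 ≡ w → ⊥
      starting-at-w⇒⊥ C at₀≡w
        with edge-preimage (Cycle.steps C {0} (s≤s z≤n)) | edge-preimage (Cycle.closes C)
      ... | x₀ , y₁ , φx₀ , φy₁ , x₀y₁ | xₙ , yₙ , φxₙ , φyₙ , xₙyₙ =
        acyclic (closePath p yₙ (preimage-avoids (avoids z≤n) φyₙ) yₙ-fresh
          (subst (λ x → Adj S x yₙ) (fibre≢w (others≢w (s≤s z≤n) ≤-refl) φxₙ) xₙyₙ)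
          (fibre-w-adj (trans φyₙ at₀≡w) (trans φx₀ at₀≡w)))
        where
        open Cycle C
        others≢w : ∀ {i} → 0 < i → i ≤ 2 + k → at i ≢ w
        others≢w 0<i i≤ eq = <⇒≢ 0<i (sym (injective i≤ z≤n (trans eq (sym at₀≡w))))

        q : ℕ → V S
        q zero    = x₀
        q (suc i) = lift (at (suc i))

        φ∘q : ∀ {i} → φ (q i) ≡ at i
        φ∘q {zero}  = φx₀
        φ∘q {suc i} = φ∘lift _

        q-steps : ∀ {i} → i < 2 + k → Adj S (q i) (q (suc i))
        q-steps {zero}  i< = subst (Adj S x₀) (fibre≢w (others≢w (s≤s z≤n) i<) φy₁) x₀y₁
        q-steps {suc i} i< = lift-adj (others≢w (s≤s z≤n) (<⇒≤ i<)) (others≢w (s≤s z≤n) i<) (steps i<)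

        p : Path S X (2 + k)
        p = record
          { at        = q
          ; injective = λ i≤ j≤ eq → injective i≤ j≤ (trans (sym φ∘q) (trans (cong φ eq) φ∘q))
          ; avoids    = λ i≤ → preimage-avoids (avoids i≤) φ∘q
          ; steps     = q-steps
          }

        yₙ-fresh : ∀ {i} → 0 < i → i ≤ 2 + k → q i ≢ yₙ
        yₙ-fresh 0<i i≤ eq = others≢w 0<i i≤ (trans (sym φ∘q) (trans (cong φ eq) (trans φyₙ at₀≡w)))

      acyclic-image : Acyclic K φ[X]
      acyclic-image C with Finₚ.any? (λ (i : Fin (3 + Cycle.k C)) → Cycle.at C (toℕ i) Finₚ.≟ w)
      ... | no  none     = missing-w⇒⊥ C λ i≤ eq →
        none (fromℕ< (s≤s i≤) , trans (cong (Cycle.at C) (Finₚ.toℕ-fromℕ< _)) eq)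
      ... | yes (i , eq) = starting-at-w⇒⊥ (rotate C (toℕ i) i≤) (trans (rotate-start C i≤) eq)
        where
        i≤ : toℕ i ≤ 2 + Cycle.k C
        i≤ = ≤-pred (Finₚ.toℕ<n i)

  fvs-contract : FvsTransfer S K
  fvs-contract X acyclic = φ[X] X , ∣φ[X]∣≤∣X∣ X , acyclic-image X acyclic

fvs-contractEdge : ∀ {S K} → ContractEdge S K → FvsTransfer S K
fvs-contractEdge (u , v , uv , φ , φ-onto , φu≡φv , φ-fibres , K-adj) =
  Contraction.fvs-contract u v uv φ φ-onto φu≡φv φ-fibres K-adj

fvs-contractions : ∀ {S K} → Star ContractEdge S K → FvsTransfer S K
fvs-contractions ε        = fvs-refl
fvs-contractions (e ◅ es) = fvs-trans (fvs-contractEdge e) (fvs-contractions es)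

fvs-minor : ∀ {H G} → Minor H G → FvsTransfer G H
fvs-minor (S , K , S⊆G , S↠K , K≅H) =
  fvs-trans (fvs-subgraph S⊆G) (fvs-trans (fvs-contractions S↠K) (fvs-iso K≅H))

smallFvs⇒¬Minor : ∀ {H G t} → IsTau H t →
  (X : Subset (Graph.n G)) → ∣ X ∣ < t → Acyclic G X → ¬ Minor H G
smallFvs⇒¬Minor {H} (_ , τ-minimal) X ∣X∣<t acyclic H≼G with fvs-minor H≼G X acyclic
... | Y , ∣Y∣≤∣X∣ , acyclicY =
  <⇒≱ ∣X∣<t (≤-trans (τ-minimal Y (acyclicY ∘ cycleAvoiding⇒Cycle {H})) ∣Y∣≤∣X∣)

StepWithin : (G : Graph) → (V G → Set) → V G → V G → Set
StepWithin G P x y = Adj G x y × P x × P y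

StepWithin-sym : ∀ {G P x y} → StepWithin G P x y → StepWithin G P y x
StepWithin-sym {G} (xy , Px , Py) = adj-sym G xy , Py , Px

module _ {G : Graph} {m : ℕ} (B : Fin m → Subset (Graph.n G))
  (interval : ∀ v (i j k : Fin m) → i Fin.≤ j → j Fin.≤ k → v ∈ B i → v ∈ B k → v ∈ B j)
  (edge-covered : ∀ x y → Adj G x y → ∃[ i ] (x ∈ B i × y ∈ B i)) where

  walk-meets-bag : (P : V G → Set) → ∀ {x y} → Star (StepWithin G P) x y → P x →
    ∀ {p q} j → x ∈ B p → y ∈ B q → p Fin.≤ j → j Fin.≤ q → ∃[ z ] (P z × z ∈ B j)
  walk-meets-bag P ε Px j x∈p x∈q p≤j j≤q = _ , Px , interval _ _ j _ p≤j j≤q x∈p x∈q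
  walk-meets-bag P {x} ((xx′ , _ , Px′) ◅ walk) Px j x∈p y∈q p≤j j≤q with edge-covered _ _ xx′
  ... | r , x∈r , x′∈r with toℕ j ≤? toℕ r
  ...   | yes j≤r = x , Px , interval x _ j r p≤j j≤r x∈p x∈r
  ...   | no  j≰r = walk-meets-bag P walk Px′ j x′∈r y∈q (<⇒≤ (≰⇒> j≰r)) j≤q

-- Complete ternary trees

-- The complete ternary tree of depth d, in preorder: vertices 0, …, size d − 1, root 0, and
-- the subtree of child c (of depth d − 1) occupying 1 + offset c (d − 1) onwards.
mutual
  nonRoot : ℕ → ℕ
  nonRoot zero    = 0
  nonRoot (suc d) = size d + size d + size d

  size : ℕ → ℕ
  size d = suc (nonRoot d)

data Child : Set where
  c₀ c₁ c₂ : Child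

offset : Child → ℕ → ℕ
offset c₀ d = 0
offset c₁ d = size d
offset c₂ d = size d + size d

offset+<nonRoot : ∀ c d {x} → x < size d → offset c d + x < nonRoot (suc d)
offset+<nonRoot c₀ d x< = <-≤-trans x< (≤-trans (m≤m+n (size d) (size d)) (m≤m+n _ (size d)))
offset+<nonRoot c₁ d x< = <-≤-trans (+-monoʳ-< (size d) x<) (m≤m+n _ (size d))
offset+<nonRoot c₂ d x< = +-monoʳ-< (size d + size d) x<

offsets-disjoint : ∀ c c′ d → c ≢ c′ →
  offset c d + size d ≤ offset c′ d ⊎ offset c′ d + size d ≤ offset c d
offsets-disjoint c₀ c₀ d c≢c′ = contradiction refl c≢c′
offsets-disjoint c₀ c₁ d _    = inj₁ ≤-refl
offsets-disjoint c₀ c₂ d _    = inj₁ (m≤m+n (size d) (size d))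
offsets-disjoint c₁ c₀ d _    = inj₂ ≤-refl
offsets-disjoint c₁ c₁ d c≢c′ = contradiction refl c≢c′
offsets-disjoint c₁ c₂ d _    = inj₁ ≤-refl
offsets-disjoint c₂ c₀ d _    = inj₂ (m≤m+n (size d) (size d))
offsets-disjoint c₂ c₁ d _    = inj₂ ≤-refl
offsets-disjoint c₂ c₂ d c≢c′ = contradiction refl c≢c′

-- The parent of 1 + o + x, for x inside a child subtree at offset o whose own parent map is p.
inChild : (ℕ → ℕ) → ℕ → ℕ → ℕ
inChild p o zero    = 0
inChild p o (suc x) = suc (o + p (suc x))

-- parent d 0 = 0 is a junk value; TreeAdj only uses parent d y for 0 < y.
parent : ℕ → ℕ → ℕ
parent zero    _       = 0
parent (suc d) zero    = 0
parent (suc d) (suc w) with w <? size d | w <? size d + size d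
... | yes _ | _     = inChild (parent d) 0 w
... | no _  | yes _ = inChild (parent d) (size d) (w ∸ size d)
... | no _  | no _  = inChild (parent d) (size d + size d) (w ∸ (size d + size d))

inChild-≤ : ∀ p o x → (∀ y → p (suc y) ≤ y) → inChild p o x ≤ o + x
inChild-≤ p o zero    _        = z≤n
inChild-≤ p o (suc x) p-below = subst (suc (o + p (suc x)) ≤_) (sym (+-suc o x))
                                  (s≤s (+-monoʳ-≤ o (p-below x)))

parent-≤ : ∀ d w → parent d (suc w) ≤ w
parent-≤ zero    w = z≤n
parent-≤ (suc d) w with w <? size d | w <? size d + size d
... | yes _  | _      = inChild-≤ (parent d) 0 w (parent-≤ d)
... | no w≮s | yes _  = subst (inChild (parent d) (size d) (w ∸ size d) ≤_) (m+[n∸m]≡n (≮⇒≥ w≮s))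
                          (inChild-≤ (parent d) (size d) (w ∸ size d) (parent-≤ d))
... | no _   | no w≮ss = subst (inChild (parent d) (size d + size d) (w ∸ (size d + size d)) ≤_)
                          (m+[n∸m]≡n (≮⇒≥ w≮ss))
                          (inChild-≤ (parent d) (size d + size d) (w ∸ (size d + size d)) (parent-≤ d))

parent-< : ∀ d {y} → 0 < y → parent d y < y
parent-< d {suc w} _ = s≤s (parent-≤ d w)

parent-inChild : ∀ c d {x} → x < size d →
  parent (suc d) (suc (offset c d + x)) ≡ inChild (parent d) (offset c d) x
parent-inChild c₀ d {x} x< with x <? size d
... | yes _  = refl
... | no x≮ = contradiction x< x≮
parent-inChild c₁ d {x} x< with size d + x <? size d | size d + x <? size d + size d
... | yes lt | _     = contradiction lt (≤⇒≯ (m≤m+n (size d) x))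
... | no _   | yes _ = cong (inChild (parent d) (size d)) (m+n∸m≡n (size d) x)
... | no _   | no ≮  = contradiction (+-monoʳ-< (size d) x<) ≮
parent-inChild c₂ d {x} x< with size d + size d + x <? size d | size d + size d + x <? size d + size d
... | yes lt | _      = contradiction lt (≤⇒≯ (≤-trans (m≤m+n (size d) (size d)) (m≤m+n _ x)))
... | no _   | yes lt = contradiction lt (≤⇒≯ (m≤m+n (size d + size d) x))
... | no _   | no _   = cong (inChild (parent d) (size d + size d)) (m+n∸m≡n (size d + size d) x)

childRoot : ℕ → Child → ℕ → ℕ
childRoot o c d = o + suc (offset c d)

childRoot+size≤ : ∀ o c d → childRoot o c d + size d ≤ o + size (suc d)
childRoot+size≤ o c d = begin
  o + suc (offset c d) + size d    ≡⟨ +-assoc o (suc (offset c d)) (size d) ⟩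
  o + suc (offset c d + size d)    ≤⟨ +-monoʳ-≤ o (s≤s (subst (_≤ nonRoot (suc d))
                                        (sym (+-suc (offset c d) (nonRoot d))) (offset+<nonRoot c d ≤-refl))) ⟩
  o + size (suc d)                 ∎
  where open ≤-Reasoning

childRoot-mono : ∀ o c c′ d → offset c d + size d ≤ offset c′ d →
  childRoot o c d + size d ≤ childRoot o c′ d
childRoot-mono o c c′ d le =
  subst (_≤ childRoot o c′ d) (sym (+-assoc o (suc (offset c d)) (size d))) (+-monoʳ-≤ o (s≤s le))

childRanges-disjoint : ∀ o d {c c′ y} → c ≢ c′ →
  childRoot o c d ≤ y → y < childRoot o c d + size d →
  childRoot o c′ d ≤ y → y < childRoot o c′ d + size d → ⊥
childRanges-disjoint o d {c} {c′} c≢c′ l u l′ u′ with offsets-disjoint c c′ d c≢c′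
... | inj₁ le = <⇒≱ u (≤-trans (childRoot-mono o c c′ d le) l′)
... | inj₂ le = <⇒≱ u′ (≤-trans (childRoot-mono o c′ c d le) l)

-- Subtree K o d: the vertices o, …, o + size d − 1 of the tree of depth K form a subtree of depth d.
data Subtree (K : ℕ) : ℕ → ℕ → Set where
  whole : Subtree K 0 K
  child : ∀ {o d} → Subtree K o (suc d) → (c : Child) → Subtree K (childRoot o c d) d

module _ {K : ℕ} where

  subtree-fits : ∀ {o d} → Subtree K o d → o + size d ≤ size K
  subtree-fits whole               = ≤-refl
  subtree-fits (child {o} {d} T c) = ≤-trans (childRoot+size≤ o c d) (subtree-fits T)

  parent-inSubtree : ∀ {o d} → Subtree K o d → ∀ {x} → 0 < x → x < size d →
    parent K (o + x) ≡ o + parent d x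
  parent-inSubtree whole _ _ = refl
  parent-inSubtree (child {o} {d} T c) {suc x} _ x< = begin
    parent K (o + suc (offset c d) + suc x)    ≡⟨ cong (parent K) (+-assoc o (suc (offset c d)) (suc x)) ⟩
    parent K (o + suc (offset c d + suc x))    ≡⟨ parent-inSubtree T (s≤s z≤n) (s≤s (offset+<nonRoot c d x<)) ⟩
    o + parent (suc d) (suc (offset c d + suc x)) ≡⟨ cong (o +_) (parent-inChild c d x<) ⟩
    o + suc (offset c d + parent d (suc x))    ≡⟨ +-assoc o (suc (offset c d)) (parent d (suc x)) ⟨
    o + suc (offset c d) + parent d (suc x)    ∎
    where open ≡-Reasoning

  parent-childRoot : ∀ {o d} → Subtree K o (suc d) → ∀ c → parent K (childRoot o c d) ≡ o
  parent-childRoot {o} {d} T c = begin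
    parent K (o + suc (offset c d))
      ≡⟨ cong (λ x → parent K (o + suc x)) (+-identityʳ (offset c d)) ⟨
    parent K (o + suc (offset c d + 0))
      ≡⟨ parent-inSubtree T (s≤s z≤n) (s≤s (offset+<nonRoot c d (s≤s z≤n))) ⟩
    o + parent (suc d) (suc (offset c d + 0))  ≡⟨ cong (o +_) (parent-inChild c d (s≤s z≤n)) ⟩
    o + 0                                      ≡⟨ +-identityʳ o ⟩
    o                                          ∎
    where open ≡-Reasoning

TreeAdj : ℕ → ℕ → ℕ → Set
TreeAdj K x y = (0 < y × parent K y ≡ x) ⊎ (0 < x × parent K x ≡ y)

treeAdj? : ∀ K x y → Dec (TreeAdj K x y)
treeAdj? K x y = ((0 <? y) ×-dec (parent K y ≟ x)) ⊎-dec ((0 <? x) ×-dec (parent K x ≟ y))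

TreeAdj-sym : ∀ K {x y} → TreeAdj K x y → TreeAdj K y x
TreeAdj-sym K (inj₁ up)   = inj₂ up
TreeAdj-sym K (inj₂ down) = inj₁ down

TreeAdj-irrefl : ∀ K {x} → ¬ TreeAdj K x x
TreeAdj-irrefl K (inj₁ (0<x , eq)) = <-irrefl eq (parent-< K 0<x)
TreeAdj-irrefl K (inj₂ (0<x , eq)) = <-irrefl eq (parent-< K 0<x)

TreeAdj-lower : ∀ K {x y} → TreeAdj K x y → x < y → parent K y ≡ x
TreeAdj-lower K (inj₁ (_ , eq))   _   = eq
TreeAdj-lower K (inj₂ (0<x , eq)) x<y = contradiction (subst (_< _) eq (parent-< K 0<x)) (<-asym x<y)

-- The apex tree

module ApexTree (a K : ℕ) where

  private
    edge : Fin a ⊎ Fin (size K) → Fin a ⊎ Fin (size K) → Bool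
    edge (inj₁ i) (inj₁ j) = not (does (i Finₚ.≟ j))
    edge (inj₁ _) (inj₂ _) = true
    edge (inj₂ _) (inj₁ _) = true
    edge (inj₂ i) (inj₂ j) = does (treeAdj? K (toℕ i) (toℕ j))

    edge-sym : ∀ p q → edge p q ≡ edge q p
    edge-sym (inj₁ i) (inj₁ j) = cong not (does-⇔ (mk⇔ sym sym) (i Finₚ.≟ j) (j Finₚ.≟ i))
    edge-sym (inj₁ _) (inj₂ _) = refl
    edge-sym (inj₂ _) (inj₁ _) = refl
    edge-sym (inj₂ i) (inj₂ j) = does-⇔ (mk⇔ (TreeAdj-sym K) (TreeAdj-sym K))
      (treeAdj? K (toℕ i) (toℕ j)) (treeAdj? K (toℕ j) (toℕ i))

    edge-irrefl : ∀ p → edge p p ≡ false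
    edge-irrefl (inj₁ i) = cong not (dec-true (i Finₚ.≟ i) refl)
    edge-irrefl (inj₂ i) = dec-false (treeAdj? K (toℕ i) (toℕ i)) (TreeAdj-irrefl K)

  G : Graph
  G = record
    { n      = a + size K
    ; E      = λ x y → edge (splitAt a x) (splitAt a y)
    ; sym    = λ x y → edge-sym (splitAt a x) (splitAt a y)
    ; irrefl = λ x → edge-irrefl (splitAt a x)
    }

  apex : Fin a → V G
  apex i = i ↑ˡ size K

  node : Fin (size K) → V G
  node j = a ↑ʳ j

  node-adj⁻ : ∀ i j → Adj G (node i) (node j) → TreeAdj K (toℕ i) (toℕ j)
  node-adj⁻ i j ij rewrite Finₚ.splitAt-↑ʳ a (size K) i | Finₚ.splitAt-↑ʳ a (size K) j =
    does⇒ (treeAdj? K _ _) ij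

  node-adj⁺ : ∀ i j → TreeAdj K (toℕ i) (toℕ j) → Adj G (node i) (node j)
  node-adj⁺ i j ij rewrite Finₚ.splitAt-↑ʳ a (size K) i | Finₚ.splitAt-↑ʳ a (size K) j =
    dec-true (treeAdj? K _ _) ij

  data Side (z : V G) : Set where
    isApex : ∀ i → z ≡ apex i → Side z
    isNode : ∀ j → z ≡ node j → Side z

  side : ∀ z → Side z
  side z with splitAt a z in eq
  ... | inj₁ i = isApex i (trans (sym (Finₚ.join-splitAt a (size K) z)) (cong (Fin.join a (size K)) eq))
  ... | inj₂ j = isNode j (trans (sym (Finₚ.join-splitAt a (size K) z)) (cong (Fin.join a (size K)) eq))

  apex-adj : ∀ i z → z ≢ apex i → Adj G (apex i) z
  apex-adj i z z≢i with side z
  ... | isNode j refl rewrite Finₚ.splitAt-↑ˡ a i (size K) | Finₚ.splitAt-↑ʳ a (size K) j = refl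
  ... | isApex j refl rewrite Finₚ.splitAt-↑ˡ a i (size K) | Finₚ.splitAt-↑ˡ a j (size K) =
    cong not (dec-false (i Finₚ.≟ j) (λ { refl → z≢i refl }))

  apex≢node : ∀ i j → apex i ≢ node j
  apex≢node i j eq
    with trans (sym (Finₚ.splitAt-↑ˡ a i (size K))) (trans (cong (splitAt a) eq) (Finₚ.splitAt-↑ʳ a (size K) j))
  ... | ()

  nodeAt : ℕ → V G
  nodeAt y = node (clamp y)

  nodeAt-toℕ : ∀ j → nodeAt (toℕ j) ≡ node j
  nodeAt-toℕ j = cong node (clamp-toℕ (≤-pred (Finₚ.toℕ<n j)) refl)

  nodeAt-injective : ∀ {y y′} → y < size K → y′ < size K → nodeAt y ≡ nodeAt y′ → y ≡ y′
  nodeAt-injective y< y′< eq = trans (sym (toℕ-clamp (≤-pred y<)))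
    (trans (cong toℕ (Finₚ.↑ʳ-injective a _ _ eq)) (toℕ-clamp (≤-pred y′<)))

  nodeAt-parent : ∀ {y} → y < size K → 0 < y → Adj G (nodeAt y) (nodeAt (parent K y))
  nodeAt-parent {y} y< 0<y = node-adj⁺ _ _ (inj₂ (subst (0 <_) (sym (toℕ-clamp (≤-pred y<))) 0<y ,
    trans (cong (parent K) (toℕ-clamp (≤-pred y<)))
          (sym (toℕ-clamp (≤-pred (<-trans (parent-< K 0<y) y<))))))

  InSubtree : ℕ → ℕ → V G → Set
  InSubtree o d z = ∃[ y ] (z ≡ nodeAt y × o ≤ y × y < o + size d)

  walkToRoot : ∀ {o d} → Subtree K o d → ∀ {y} → o ≤ y → y < o + size d →
    Star (StepWithin G (InSubtree o d)) (nodeAt y) (nodeAt o)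
  walkToRoot {o} {d} T {y} o≤y y< = subst (λ v → ToRoot (nodeAt v)) (m+[n∸m]≡n o≤y)
    (<-rec Walk walk (y ∸ o) (+-cancelˡ-< o _ _ (subst (_< o + size d) (sym (m+[n∸m]≡n o≤y)) y<)))
    where
    ToRoot : V G → Set
    ToRoot z = Star (StepWithin G (InSubtree o d)) z (nodeAt o)
    Walk : ℕ → Set
    Walk x = x < size d → ToRoot (nodeAt (o + x))
    walk : ∀ x → (∀ {x′} → x′ < x → Walk x′) → Walk x
    walk zero    _    _  = subst (ToRoot ∘ nodeAt) (sym (+-identityʳ o)) ε
    walk (suc x) rec x< = (to-parent , (_ , refl , m≤m+n o _ , +-monoʳ-< o x<)
                                     , (_ , refl , m≤m+n o _ , +-monoʳ-< o p<))
                          ◅ rec (parent-< d (s≤s z≤n)) p<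
      where
      p< : parent d (suc x) < size d
      p< = <-trans (parent-< d (s≤s z≤n)) x<
      to-parent : Adj G (nodeAt (o + suc x)) (nodeAt (o + parent d (suc x)))
      to-parent = subst (Adj G (nodeAt (o + suc x)) ∘ nodeAt) (parent-inSubtree T (s≤s z≤n) x<)
        (nodeAt-parent (<-≤-trans (+-monoʳ-< o x<) (subtree-fits T)) (<-≤-trans (s≤s z≤n) (m≤n+m _ o)))

  IsApex : V G → Set
  IsApex z = ∃[ i ] apex i ≡ z

  isApex? : ∀ z → Dec (IsApex z)
  isApex? z with side z
  ... | isApex i eq = yes (i , sym eq)
  ... | isNode j eq = no λ { (i , eq′) → apex≢node i j (trans eq′ eq) }

  apices : Subset (Graph.n G)
  apices = subsetOf isApex?

  ∣apices∣≤a : ∣ apices ∣ ≤ a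
  ∣apices∣≤a = subst (∣ apices ∣ ≤_) (∣⊤∣≡n a) (⊆-image⇒∣p∣≤∣q∣ apices ⊤ apex
    λ z∈ → let (i , eq) = ∈-subsetOf⁻ isApex? z∈ in i , ∈⊤ , eq)

  outside-apices : ∀ {z} → z ∉ apices → ∃[ j ] z ≡ node j
  outside-apices {z} z∉ with side z
  ... | isApex i eq = contradiction (∈-subsetOf⁺ isApex? (i , sym eq)) z∉
  ... | isNode j eq = j , eq

  -- Apices get the junk height 0; only heights off the apices matter.
  height : V G → ℕ
  height z = [ const 0 , toℕ ]′ (splitAt a z)

  height-node : ∀ j → height (node j) ≡ toℕ j
  height-node j = cong [ const 0 , toℕ ]′ (Finₚ.splitAt-↑ʳ a (size K) j)

  acyclic-apices : Acyclic G apices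
  acyclic-apices = acyclic-byHeight G apices height h-injective lower-unique
    where
    h-injective : ∀ {x y} → x ∉ apices → y ∉ apices → height x ≡ height y → x ≡ y
    h-injective x∉ y∉ eq with outside-apices x∉ | outside-apices y∉
    ... | i , refl | j , refl =
      cong node (Finₚ.toℕ-injective (trans (sym (height-node i)) (trans eq (height-node j))))
    lower-unique : ∀ {x y z} → x ∉ apices → y ∉ apices → z ∉ apices → Adj G x z → Adj G y z →
                   height x < height z → height y < height z → x ≡ y
    lower-unique x∉ y∉ z∉ xz yz x< y< with outside-apices x∉ | outside-apices y∉ | outside-apices z∉
    ... | i , refl | j , refl | l , refl = h-injective x∉ y∉ (begin
      height (node i)   ≡⟨ height-node i ⟩
      toℕ i             ≡⟨ TreeAdj-lower K (node-adj⁻ i l xz) (subst₂ _<_ (height-node i) (height-node l) x<) ⟨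
      parent K (toℕ l)  ≡⟨ TreeAdj-lower K (node-adj⁻ j l yz) (subst₂ _<_ (height-node j) (height-node l) y<) ⟩
      toℕ j             ≡⟨ height-node j ⟨
      height (node j)   ∎)
      where open ≡-Reasoning

  nodes-connected : ∀ {X} → (∀ j → node j ∉ X) → ∀ i j → Star (StepAvoiding G X) (node i) (node j)
  nodes-connected {X} node∉X i j = toRoot i ◅◅ Star.reverse StepAvoiding-sym (toRoot j)
    where
    StepAvoiding-sym : ∀ {x y} → StepAvoiding G X x y → StepAvoiding G X y x
    StepAvoiding-sym (xy , x∉ , y∉) = adj-sym G xy , y∉ , x∉
    avoiding : ∀ {x y} → StepWithin G (InSubtree 0 K) x y → StepAvoiding G X x y
    avoiding (xy , (_ , refl , _) , (_ , refl , _)) = xy , node∉X _ , node∉X _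
    toRoot : ∀ i → Star (StepAvoiding G X) (node i) (node zero)
    toRoot i = subst₂ (Star (StepAvoiding G X)) (nodeAt-toℕ i) (nodeAt-toℕ zero)
      (Star.map avoiding (walkToRoot whole z≤n (Finₚ.toℕ<n i)))

  via-apex : ∀ {X} i → apex i ∉ X → ConnectedAfterDeleting G X
  via-apex i apex∉X x y x∉ y∉ with x Finₚ.≟ apex i | y Finₚ.≟ apex i
  ... | yes refl | yes refl = ε
  ... | yes refl | no y≢    = (apex-adj i y y≢ , x∉ , y∉) ◅ ε
  ... | no x≢    | yes refl = (adj-sym G (apex-adj i x x≢) , x∉ , y∉) ◅ ε
  ... | no x≢    | no y≢    =
    (adj-sym G (apex-adj i x x≢) , x∉ , apex∉X) ◅ (apex-adj i y y≢ , apex∉X , y∉) ◅ ε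

  -- Deleting at most a vertices either spares an apex, or deletes exactly the apices.
  connected : ∀ X → ∣ X ∣ ≤ a → ConnectedAfterDeleting G X
  connected X ∣X∣≤a with Finₚ.any? (λ i → ¬? (apex i ∈? X))
  ... | yes (i , apex∉X) = via-apex i apex∉X
  ... | no none = connect
    where
    apex∈X : ∀ i → apex i ∈ X
    apex∈X i = decidable-stable (apex i ∈? X) (λ apex∉X → none (i , apex∉X))
    node∉X : ∀ j → node j ∉ X
    node∉X j node∈X = 1+n≰n (≤-trans (injective⇒n≤∣q∣ X f f-injective f∈X) ∣X∣≤a)
      where
      f : Fin (suc a) → V G
      f zero    = node j
      f (suc i) = apex i
      f∈X : ∀ x → f x ∈ X
      f∈X zero    = node∈X
      f∈X (suc i) = apex∈X i
      f-injective : ∀ {x y} → f x ≡ f y → x ≡ y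
      f-injective {zero}  {zero}   _  = refl
      f-injective {zero}  {suc i}  eq = contradiction (sym eq) (apex≢node i j)
      f-injective {suc i} {zero}   eq = contradiction eq (apex≢node i j)
      f-injective {suc i} {suc i′} eq = cong suc (Finₚ.↑ˡ-injective (size K) i i′ eq)
    connect : ConnectedAfterDeleting G X
    connect x y x∉ y∉ with side x | side y
    ... | isApex i refl | _             = contradiction (apex∈X i) x∉
    ... | isNode _ _    | isApex i refl = contradiction (apex∈X i) y∉
    ... | isNode i refl | isNode j refl = nodes-connected node∉X i j

  kConnected : ∀ {g} → 1 < size K → g ≤ suc a → KConnected g G
  kConnected 1<size g≤ = ≤-trans (s≤s g≤) (subst (_≤ a + size K) (+-comm a 2) (+-monoʳ-≤ a 1<size)) ,
    λ X ∣X∣<g → connected X (≤-pred (≤-trans ∣X∣<g g≤))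

-- Pathwidth of the apex tree

∃-median : (f : Child → ℕ) →
  ∃[ cˡ ] ∃[ cᵐ ] ∃[ cʳ ] (cˡ ≢ cᵐ × cʳ ≢ cᵐ × f cˡ ≤ f cᵐ × f cᵐ ≤ f cʳ)
∃-median f with ≤-total (f c₀) (f c₁) | ≤-total (f c₁) (f c₂) | ≤-total (f c₀) (f c₂)
... | inj₁ 0≤1 | inj₁ 1≤2 | _        = c₀ , c₁ , c₂ , (λ ()) , (λ ()) , 0≤1 , 1≤2
... | inj₁ 0≤1 | inj₂ 2≤1 | inj₁ 0≤2 = c₀ , c₂ , c₁ , (λ ()) , (λ ()) , 0≤2 , 2≤1
... | inj₁ 0≤1 | inj₂ 2≤1 | inj₂ 2≤0 = c₂ , c₀ , c₁ , (λ ()) , (λ ()) , 2≤0 , 0≤1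
... | inj₂ 1≤0 | inj₁ 1≤2 | inj₁ 0≤2 = c₁ , c₀ , c₂ , (λ ()) , (λ ()) , 1≤0 , 0≤2
... | inj₂ 1≤0 | inj₁ 1≤2 | inj₂ 2≤0 = c₁ , c₂ , c₀ , (λ ()) , (λ ()) , 1≤2 , 2≤0
... | inj₂ 1≤0 | inj₂ 2≤1 | _        = c₂ , c₁ , c₀ , (λ ()) , (λ ()) , 2≤1 , 1≤0

module LargeBag (a K : ℕ) {m : ℕ} (B : Fin m → Subset (Graph.n (ApexTree.G a K)))
  (covers : ∀ v → ∃[ i ] v ∈ B i)
  (interval : ∀ v (i j k : Fin m) → i Fin.≤ j → j Fin.≤ k → v ∈ B i → v ∈ B k → v ∈ B j)
  (edge-covered : ∀ x y → Adj (ApexTree.G a K) x y → ∃[ i ] (x ∈ B i × y ∈ B i)) where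

  open ApexTree a K

  FullBag : ℕ → ℕ → Set
  FullBag o d = ∃[ j ] Σ (Fin (suc d) → V G) λ f →
    Injective _≡_ _≡_ f × (∀ i → f i ∈ B j × InSubtree o d (f i))

  fullBag-leaf : ∀ o → FullBag o 0
  fullBag-leaf o with covers (nodeAt o)
  ... | j , o∈j = j , (λ _ → nodeAt o) , (λ { {zero} {zero} _ → refl }) ,
                  λ { zero → o∈j , (o , refl , ≤-refl , m<m+n o (s≤s z≤n)) }

  module _ {o d} (T : Subtree K o (suc d)) (cᵐ : Child) where

    Outside : V G → Set
    Outside z = InSubtree o (suc d) z × ¬ InSubtree (childRoot o cᵐ d) d z

    widen : ∀ c {z} → InSubtree (childRoot o c d) d z → InSubtree o (suc d) z
    widen c (y , eq , l , u) = y , eq , ≤-trans (m≤m+n o _) l , <-≤-trans u (childRoot+size≤ o c d)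

    sibling-outside : ∀ {c} → c ≢ cᵐ → ∀ {z} → InSubtree (childRoot o c d) d z → Outside z
    sibling-outside {c} c≢cᵐ z∈ = widen c z∈ , not-in-cᵐ z∈
      where
      not-in-cᵐ : ∀ {z} → InSubtree (childRoot o c d) d z → ¬ InSubtree (childRoot o cᵐ d) d z
      not-in-cᵐ (y , refl , l , u) (y′ , eq , l′ , u′) =
        childRanges-disjoint o d c≢cᵐ l u (subst (_ ≤_) (sym y≡y′) l′) (subst (_< _) (sym y≡y′) u′)
        where
        y≡y′ : y ≡ y′
        y≡y′ = nodeAt-injective (<-≤-trans u (subtree-fits (child T c)))
                                (<-≤-trans u′ (subtree-fits (child T cᵐ))) eq

    root-outside : Outside (nodeAt o)
    root-outside = (o , refl , ≤-refl , m<m+n o (s≤s z≤n)) , λ { (y , eq , l , u) →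
      <⇒≱ (m<m+n o (s≤s z≤n))
          (subst (childRoot o cᵐ d ≤_) (sym (nodeAt-injective o< (<-≤-trans u (subtree-fits (child T cᵐ))) eq)) l) }
      where
      o< : o < size K
      o< = <-≤-trans (m<m+n o (s≤s z≤n)) (subtree-fits T)

    walk-up : ∀ {c} → c ≢ cᵐ → ∀ {y} → childRoot o c d ≤ y → y < childRoot o c d + size d →
      Star (StepWithin G Outside) (nodeAt y) (nodeAt o)
    walk-up {c} c≢cᵐ l u =
      Star.map (λ (xy , x∈ , y∈) → xy , sibling-outside c≢cᵐ x∈ , sibling-outside c≢cᵐ y∈)
               (walkToRoot (child T c) l u)
      ◅◅ (to-root , sibling-outside c≢cᵐ (_ , refl , ≤-refl , m<m+n _ (s≤s z≤n)) , root-outside) ◅ ε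
      where
      to-root : Adj G (nodeAt (childRoot o c d)) (nodeAt o)
      to-root = subst (Adj G (nodeAt (childRoot o c d)) ∘ nodeAt) (parent-childRoot T c)
        (nodeAt-parent (<-≤-trans (m<m+n _ (s≤s z≤n)) (subtree-fits (child T c)))
                       (<-≤-trans (s≤s z≤n) (m≤n+m _ o)))

    -- The walk from child cˡ up to the root and down to child cʳ meets the bag of cᵐ outside cᵐ.
    fullBag-step : ∀ {cˡ cʳ} → cˡ ≢ cᵐ → cʳ ≢ cᵐ →
      (rˡ : FullBag (childRoot o cˡ d) d) (rᵐ : FullBag (childRoot o cᵐ d) d)
      (rʳ : FullBag (childRoot o cʳ d) d) →
      proj₁ rˡ Fin.≤ proj₁ rᵐ → proj₁ rᵐ Fin.≤ proj₁ rʳ → FullBag o (suc d)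
    fullBag-step cˡ≢cᵐ cʳ≢cᵐ (jˡ , fˡ , _ , inˡ) (jᵐ , fᵐ , fᵐ-inj , inᵐ) (jʳ , fʳ , _ , inʳ) jˡ≤jᵐ jᵐ≤jʳ
      with inˡ zero | inʳ zero
    ... | fˡ∈ , yˡ , eqˡ , lˡ , uˡ | fʳ∈ , yʳ , eqʳ , lʳ , uʳ
      with walk-meets-bag {G} B interval edge-covered Outside
             (walk-up cˡ≢cᵐ lˡ uˡ ◅◅ Star.reverse (StepWithin-sym {G}) (walk-up cʳ≢cᵐ lʳ uʳ))
             (sibling-outside cˡ≢cᵐ (yˡ , refl , lˡ , uˡ)) jᵐ
             (subst (_∈ B jˡ) eqˡ fˡ∈) (subst (_∈ B jʳ) eqʳ fʳ∈) jˡ≤jᵐ jᵐ≤jʳ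
    ... | z , (z∈ , z∉cᵐ) , z∈jᵐ = jᵐ , f , f-injective , f-in
      where
      f : Fin (suc (suc d)) → V G
      f zero    = z
      f (suc i) = fᵐ i
      f-injective : Injective _≡_ _≡_ f
      f-injective {zero}  {zero}  _  = refl
      f-injective {zero}  {suc i} eq = contradiction (subst (InSubtree _ d) (sym eq) (proj₂ (inᵐ i))) z∉cᵐ
      f-injective {suc i} {zero}  eq = contradiction (subst (InSubtree _ d) eq (proj₂ (inᵐ i))) z∉cᵐ
      f-injective {suc i} {suc j} eq = cong suc (fᵐ-inj eq)
      f-in : ∀ i → f i ∈ B jᵐ × InSubtree o (suc d) (f i)
      f-in zero    = z∈jᵐ , z∈
      f-in (suc i) = proj₁ (inᵐ i) , widen cᵐ (proj₂ (inᵐ i))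

  fullBag : ∀ {o d} → Subtree K o d → FullBag o d
  fullBag {o} {zero}  T = fullBag-leaf o
  fullBag {o} {suc d} T with ∃-median (λ c → toℕ (proj₁ (fullBag (child T c))))
  ... | cˡ , cᵐ , cʳ , cˡ≢cᵐ , cʳ≢cᵐ , jˡ≤jᵐ , jᵐ≤jʳ =
    fullBag-step T cᵐ cˡ≢cᵐ cʳ≢cᵐ (fullBag (child T cˡ)) (fullBag (child T cᵐ)) (fullBag (child T cʳ))
      jˡ≤jᵐ jᵐ≤jʳ

  large-bag : ∃[ j ] (suc K ≤ ∣ B j ∣)
  large-bag with fullBag whole
  ... | j , f , f-injective , f-in = j , injective⇒n≤∣q∣ (B j) f f-injective (proj₁ ∘ f-in)

apexTree-pathwidth≥ : ∀ a K c → PathwidthAtMost (ApexTree.G a K) c → K ≤ c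
apexTree-pathwidth≥ a K c (m , B , covers , interval , edge-covered , narrow)
  with LargeBag.large-bag a K B covers interval edge-covered
... | j , 1+K≤∣Bj∣ = ≤-pred (≤-trans 1+K≤∣Bj∣ (narrow j))

proposition9 : (H : Graph) (t : ℕ) → IsTau H t → 1 ≤ t →
    (g : ℕ) → g ≤ t → ¬ Works H g
proposition9 H (suc a) τH≡t _ g g≤t (c , works) =
  1+n≰n (apexTree-pathwidth≥ a (suc c) c (works G (kConnected (s≤s (s≤s z≤n)) g≤t) no-H-minor))
  where
  open ApexTree a (suc c)
  no-H-minor : ¬ Minor H G
  no-H-minor = smallFvs⇒¬Minor {H} {G} τH≡t apices (s≤s ∣apices∣≤a) acyclic-apices
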